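{- Let $G$ be a bipartite TRVG with a TRVG representation in which the vertices of one part are represented by $p$ rectangles $g_1,\dots,g_p$ (green) and the vertices of the other part by $q$ rectangles $r_1,\dots,r_q$ (red). If, for each $i\in\{1,\dots,p\}$, $g_i$ sees exactly $\alpha_i$ red rectangles horizontally, then \[q\ \ge\ \alpha_1+\alpha_2+\dots+\alpha_p-(p-1).\]
   Context: A graph $G$ is a transparent rectangle visibility graph (TRVG) if there is a collection (a representation) of rectangles in the plane with sides parallel to the coordinate axes and pairwise disjoint interiors, one rectangle $R_v$ for each vertex $v$, such that for distinct vertices $u,v$: $u$ and $v$ are adjacent if and only if there is a horizontal or a vertical line meeting the interiors of both $R_u$ and $R_v$ (other rectangles in between do not block visibility). Rectangle $A$ sees rectangle $B$ horizontally if some horizontal line meets the interiors of both.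
   Formalization: The rectangles of the TRVG representation have rational coordinates. -}

module Defs where

open import Data.Rational using (ℚ; _<_)
open import Data.Rational.Properties using (_<?_)
open import Data.Nat using (ℕ; _+_; _∸_; _≤_)
open import Data.Fin using (Fin)
open import Data.List using (List; length; filter; allFin)
open import Data.Product using (_×_; _,_)
open import Relation.Nullary using (¬_; Dec)
open import Relation.Nullary.Decidable using (_×-dec_)
open import Relation.Binary.PropositionalEquality using (_≢_)

record Rect : Set where
  constructor rect
  field
    x₁ x₂ y₁ y₂ : ℚ
    x₁<x₂ : x₁ < x₂
    y₁<y₂ : y₁ < y₂
open Rect public

OpenOverlap : ℚ → ℚ → ℚ → ℚ → Set
OpenOverlap a₁ a₂ b₁ b₂ = (a₁ < b₂) × (b₁ < a₂)

-- some horizontal line meets the interiors of both rectangles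
SeesH : Rect → Rect → Set
SeesH A B = OpenOverlap (y₁ A) (y₂ A) (y₁ B) (y₂ B)

-- some vertical line meets the interiors of both rectangles
SeesV : Rect → Rect → Set
SeesV A B = OpenOverlap (x₁ A) (x₂ A) (x₁ B) (x₂ B)

Sees : Rect → Rect → Set
Sees A B = SeesH A B Data.Sum.⊎ SeesV A B
  where import Data.Sum

DisjointInteriors : Rect → Rect → Set
DisjointInteriors A B = ¬ (SeesV A B × SeesH A B)

seesH? : (A B : Rect) → Dec (SeesH A B)
seesH? A B = (y₁ A <? y₂ B) ×-dec (y₁ B <? y₂ A)

countSeesH : ∀ {q} → Rect → (Fin q → Rect) → ℕ
countSeesH {q} g r = length (filter (λ j → seesH? g (r j)) (allFin q))

record BipartiteTRVGRep (p q : ℕ) (g : Fin p → Rect) (r : Fin q → Rect) : Set where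
  field
    disj-gg : ∀ i j → i ≢ j → DisjointInteriors (g i) (g j)
    disj-rr : ∀ i j → i ≢ j → DisjointInteriors (r i) (r j)
    disj-gr : ∀ i j → DisjointInteriors (g i) (r j)
    noEdge-gg : ∀ i j → i ≢ j → ¬ Sees (g i) (g j)
    noEdge-rr : ∀ i j → i ≢ j → ¬ Sees (r i) (r j)

{-# OPTIONS --safe #-}
-- The αᵢ sum to the number of horizontal visibilities between the two
-- colours, which depend only on the open y-projections of the rectangles;
-- since no two rectangles of the same colour see each other, these intervals
-- are pairwise disjoint within each colour (nothing else about the
-- representation is needed).  Among all p + q rectangles, the one with the
-- lowest top sees at most one rectangle of the other colour horizontally: two
-- of them would overlap just below that top.  Deleting it and repeating, the
-- p + q rectangles carry at most p + q − 1 horizontal visibilities.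
module Submission where

open import Defs
open import Data.Nat using (ℕ; zero; suc; _+_; _∸_; _≤_; z≤n; s≤s)
open import Data.Fin using (Fin; zero; suc; punchIn; _≟_)
open import Data.List using (map; allFin; length; filter; tabulate)
open import Data.Nat.ListAction using (sum)
open import Relation.Binary.PropositionalEquality using (_≡_; _≢_; refl; trans; cong; module ≡-Reasoning)

open import Data.Nat.Properties
  using (+-0-commutativeMonoid; +-monoˡ-≤; +-suc; +-comm; ≤-reflexive; ≤-trans; module ≤-Reasoning)
open import Data.Fin.Properties using (0≢1+n; punchIn-injective; suc-injective)
open import Data.Rational as ℚ using ()
open import Data.Rational.Properties as ℚ using ()
open import Data.List.Properties using (map-tabulate)
open import Data.List.Relation.Unary.All as All using ()
open import Data.List.Membership.Propositional.Properties using (∈-allFin)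
open import Relation.Binary.Bundles using (DecTotalOrder)
open import Data.List.Extrema (DecTotalOrder.totalOrder ℚ.≤-decTotalOrder) using (argmin; f[argmin]≤f[xs])
open import Data.Product using (_,_; swap)
open import Data.Sum using (inj₁; inj₂)
open import Data.Bool using (if_then_else_)
open import Data.Vec.Functional using (Vector; removeAt)
open import Function using (_∘_; id)
open import Function.Bundles using (_⇔_; mk⇔)
open import Relation.Nullary using (Dec; yes; no; does; ¬_)
open import Relation.Nullary.Decidable using (does-⇔; dec-false; decidable-stable)
open import Relation.Unary using (Pred; Decidable)
open import Algebra.Properties.CommutativeMonoid.Sum +-0-commutativeMonoid
  using (sum-syntax; sum-remove; ∑-comm; sum-cong-≗; sum-replicate-zero)

indicator : ∀ {P : Set} → Dec P → ℕ
indicator P? = if does P? then 1 else 0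

indicator-⇔ : ∀ {P Q : Set} → P ⇔ Q → (P? : Dec P) (Q? : Dec Q) → indicator P? ≡ indicator Q?
indicator-⇔ P⇔Q P? Q? = cong (if_then 1 else 0) (does-⇔ P⇔Q P? Q?)

length-filter-tabulate : ∀ {A : Set} {P : Pred A _} (P? : Decidable P) {n} (f : Fin n → A) →
  length (filter P? (tabulate f)) ≡ ∑[ i < n ] indicator (P? (f i))
length-filter-tabulate P? {zero} f = refl
length-filter-tabulate P? {suc n} f with P? (f zero)
... | yes _ = cong suc (length-filter-tabulate P? (f ∘ suc))
... | no _ = length-filter-tabulate P? (f ∘ suc)

sum-tabulate : ∀ {n} (f : Fin n → ℕ) → sum (tabulate f) ≡ ∑[ i < n ] f i
sum-tabulate {zero} f = refl
sum-tabulate {suc n} f = cong (f zero +_) (sum-tabulate (f ∘ suc))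

∑-indicator-≡0 : ∀ {n} {P : Pred (Fin n) _} (P? : Decidable P) → (∀ i → ¬ P i) →
  ∑[ i < n ] indicator (P? i) ≡ 0
∑-indicator-≡0 {n} P? ¬P = begin
  ∑[ i < n ] indicator (P? i) ≡⟨ sum-cong-≗ (λ i → cong (if_then 1 else 0) (dec-false (P? i) (¬P i))) ⟩
  ∑[ i < n ] 0                ≡⟨ sum-replicate-zero n ⟩
  0                           ∎
  where open ≡-Reasoning

∑-indicator-≤1 : ∀ {n} {P : Pred (Fin n) _} (P? : Decidable P) → (∀ {i j} → P i → P j → i ≡ j) →
  ∑[ i < n ] indicator (P? i) ≤ 1
∑-indicator-≤1 {zero} P? unique = z≤n
∑-indicator-≤1 {suc n} P? unique with P? zero
... | yes P0 = ≤-reflexive (cong suc (∑-indicator-≡0 (P? ∘ suc) (λ i Pi → 0≢1+n (unique P0 Pi))))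
... | no _ = ∑-indicator-≤1 (P? ∘ suc) (λ Pi Pj → suc-injective (unique Pi Pj))

HIndependent : ∀ {n} → Vector Rect n → Set
HIndependent r = ∀ i j → i ≢ j → ¬ SeesH (r i) (r j)

HIndependent-removeAt : ∀ {n} (r : Vector Rect (suc n)) → HIndependent r → ∀ i → HIndependent (removeAt r i)
HIndependent-removeAt r indep i j k j≢k = indep (punchIn i j) (punchIn i k) (j≢k ∘ punchIn-injective i j k)

seesH-⇔ : ∀ {A B} → SeesH A B ⇔ SeesH B A
seesH-⇔ = mk⇔ swap swap

-- Both B and C contain the part of A's interval just below the top of A.
seesH-below-top : ∀ {A B C} → SeesH A B → SeesH A C → y₂ A ℚ.≤ y₂ B → y₂ A ℚ.≤ y₂ C → SeesH B C
seesH-below-top (_ , y₁B<y₂A) (_ , y₁C<y₂A) y₂A≤y₂B y₂A≤y₂C =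
  ℚ.<-≤-trans y₁B<y₂A y₂A≤y₂C , ℚ.<-≤-trans y₁C<y₂A y₂A≤y₂B

lowest : ∀ {n} → Vector Rect (suc n) → Fin (suc n)
lowest r = argmin (y₂ ∘ r) zero (allFin _)

lowest-≤ : ∀ {n} (r : Vector Rect (suc n)) j → y₂ (r (lowest r)) ℚ.≤ y₂ (r j)
lowest-≤ r j = All.lookup (f[argmin]≤f[xs] {f = y₂ ∘ r} zero (allFin _)) (∈-allFin j)

degreeH : ∀ {q} → Rect → Vector Rect q → ℕ
degreeH {q} A r = ∑[ j < q ] indicator (seesH? A (r j))

degreeH-≤1 : ∀ {q} A (r : Vector Rect q) → HIndependent r → (∀ j → y₂ A ℚ.≤ y₂ (r j)) → degreeH A r ≤ 1
degreeH-≤1 A r indep A-lowest = ∑-indicator-≤1 (seesH? A ∘ r) λ {j} {k} A~rj A~rk →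
  decidable-stable (j ≟ k) λ j≢k →
    indep j k j≢k (seesH-below-top {A} {r j} {r k} A~rj A~rk (A-lowest j) (A-lowest k))

countSeesH≡degreeH : ∀ {q} A (r : Vector Rect q) → countSeesH A r ≡ degreeH A r
countSeesH≡degreeH A r = length-filter-tabulate (seesH? A ∘ r) id

edgesH : ∀ {p q} → Vector Rect p → Vector Rect q → ℕ
edgesH {p} g r = ∑[ i < p ] degreeH (g i) r

edgesH-comm : ∀ {p q} (g : Vector Rect p) (r : Vector Rect q) → edgesH g r ≡ edgesH r g
edgesH-comm {p} {q} g r = begin
  ∑[ i < p ] ∑[ j < q ] indicator (seesH? (g i) (r j)) ≡⟨ ∑-comm (λ i j → indicator (seesH? (g i) (r j))) ⟩
  ∑[ j < q ] ∑[ i < p ] indicator (seesH? (g i) (r j)) ≡⟨ sum-cong-≗ (λ j → sum-cong-≗ (λ i → swapped i j)) ⟩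
  ∑[ j < q ] ∑[ i < p ] indicator (seesH? (r j) (g i)) ∎
  where
  open ≡-Reasoning
  swapped : ∀ i j → indicator (seesH? (g i) (r j)) ≡ indicator (seesH? (r j) (g i))
  swapped i j = indicator-⇔ (seesH-⇔ {g i} {r j}) (seesH? (g i) (r j)) (seesH? (r j) (g i))

edgesH-removeAt-lowest : ∀ {p q} (g : Vector Rect (suc p)) (r : Vector Rect q) i →
  HIndependent r → (∀ j → y₂ (g i) ℚ.≤ y₂ (r j)) → edgesH g r ≤ 1 + edgesH (removeAt g i) r
edgesH-removeAt-lowest g r i indep gi-lowest =
  ≤-trans (≤-reflexive (sum-remove {i = i} (λ k → degreeH (g k) r)))
    (+-monoˡ-≤ (edgesH (removeAt g i) r) (degreeH-≤1 (g i) r indep gi-lowest))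

edgesH-≤ : ∀ {p q} (g : Vector Rect p) (r : Vector Rect q) → HIndependent g → HIndependent r →
  edgesH g r ≤ p + q ∸ 1
edgesH-≤ {zero} g r _ _ = z≤n
edgesH-≤ {suc p} {zero} g r _ _ = ≤-trans (≤-reflexive (sum-replicate-zero (suc p))) z≤n
edgesH-≤ {suc p} {suc q} g r g-indep r-indep
  with ℚ.≤-total (y₂ (g (lowest g))) (y₂ (r (lowest r)))
... | inj₁ g≤r = begin
  edgesH g r                        ≤⟨ edgesH-removeAt-lowest g r i r-indep (λ j → ℚ.≤-trans g≤r (lowest-≤ r j)) ⟩
  1 + edgesH (removeAt g i) r       ≤⟨ s≤s (edgesH-≤ (removeAt g i) r (HIndependent-removeAt g g-indep i) r-indep) ⟩
  1 + (p + suc q ∸ 1)               ≡⟨ cong (λ n → suc (n ∸ 1)) (+-suc p q) ⟩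
  suc (p + q)                       ≡⟨ +-suc p q ⟨
  p + suc q                         ∎
  where
  open ≤-Reasoning
  i = lowest g
... | inj₂ r≤g = begin
  edgesH g r                        ≡⟨ edgesH-comm g r ⟩
  edgesH r g                        ≤⟨ edgesH-removeAt-lowest r g j g-indep (λ i → ℚ.≤-trans r≤g (lowest-≤ g i)) ⟩
  1 + edgesH (removeAt r j) g       ≡⟨ cong suc (edgesH-comm (removeAt r j) g) ⟩
  1 + edgesH g (removeAt r j)       ≤⟨ s≤s (edgesH-≤ g (removeAt r j) g-indep (HIndependent-removeAt r r-indep j)) ⟩
  suc (p + q)                       ≡⟨ +-suc p q ⟨
  p + suc q                         ∎
  where
  open ≤-Reasoning
  j = lowest r

lemma5p1 : (p q : ℕ) → 1 ≤ p → (g : Fin p → Rect) → (r : Fin q → Rect)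
    → BipartiteTRVGRep p q g r
    → (α : Fin p → ℕ) → (∀ i → α i ≡ countSeesH (g i) r)
    → sum (map α (allFin p)) ≤ q + (p ∸ 1)
lemma5p1 (suc p) q _ g r rep α α≡count = begin
  sum (map α (allFin (suc p))) ≡⟨ cong sum (map-tabulate id α) ⟩
  sum (tabulate α)             ≡⟨ sum-tabulate α ⟩
  ∑[ i < suc p ] α i           ≡⟨ sum-cong-≗ (λ i → trans (α≡count i) (countSeesH≡degreeH (g i) r)) ⟩
  edgesH g r                   ≤⟨ edgesH-≤ g r (λ i j i≢j → noEdge-gg i j i≢j ∘ inj₁)
                                               (λ i j i≢j → noEdge-rr i j i≢j ∘ inj₁) ⟩
  p + q                        ≡⟨ +-comm p q ⟩
  q + p                        ∎
  where
  open BipartiteTRVGRep rep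
  open ≤-Reasoning
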